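{- Let $G$ be a finite simple oriented graph with a fully traversable pebbling assignment $(S_G)$. If the underlying undirected graph of $G$ contains a cycle, then $G$ is not isomorphic (as a directed graph) to $[S_G]$.
   Context: An oriented graph is a directed graph with no loops, no multiple edges and no pair of opposite edges. A pebbling assignment $(S_G)$ on $G$ assigns a nonnegative integer number of pebbles to each vertex. A pebbling move along an edge $(v,w)$ (allowed when $v$ has at least two pebbles) removes two pebbles from $v$ and adds one pebble to $w$. The assignment graph $[S_G]$ is the directed graph whose vertices are all assignments obtainable from $(S_G)$ by finite sequences of pebbling moves (including $(S_G)$ itself), with a directed edge from $A$ to $B$ whenever $B$ is obtained from $A$ by a single pebbling move. $(S_G)$ is fully traversable if $G$ has at least one edge and for every edge $(v,w)$ of $G$ some assignment reachable from $(S_G)$ admits a pebbling move along $(v,w)$. -}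

module Defs where

open import Data.Nat using (ℕ; suc; _∸_; _≤_)
open import Data.Bool using (Bool; T)
open import Data.Fin using (Fin)
open import Data.Vec using (Vec; lookup; _[_]%=_)
open import Data.List using (List; []; _∷_; _++_; [_]; length)
open import Data.List.Relation.Unary.Unique.Propositional using (Unique)
open import Data.Product using (Σ; ∃; ∃-syntax; _×_)
open import Data.Sum using (_⊎_)
open import Data.Unit using (⊤)
open import Relation.Nullary using (¬_)
open import Relation.Binary.PropositionalEquality using (_≡_)
open import Relation.Binary.Construct.Closure.ReflexiveTransitive using (Star)
open import Function using (_⇔_)

record Digraph : Set where
  field
    n   : ℕ
    adj : Fin n → Fin n → Bool

  Edge : Fin n → Fin n → Set
  Edge u v = T (adj u v)

open Digraph public

IsOriented : Digraph → Set
IsOriented G = (∀ v → ¬ Edge G v v) × (∀ u v → Edge G u v → ¬ Edge G v u)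

Adj : (G : Digraph) → Fin (n G) → Fin (n G) → Set
Adj G u v = Edge G u v ⊎ Edge G v u

Chain : (G : Digraph) → List (Fin (n G)) → Set
Chain G []           = ⊤
Chain G (x ∷ [])     = ⊤
Chain G (x ∷ y ∷ ys) = Adj G x y × Chain G (y ∷ ys)

HasUndirectedCycle : Digraph → Set
HasUndirectedCycle G =
  ∃[ x ] ∃[ xs ] (3 ≤ length (x ∷ xs) × Unique (x ∷ xs) × Chain G (x ∷ xs ++ [ x ]))

Assignment : Digraph → Set
Assignment G = Vec ℕ (n G)

move : (G : Digraph) → Assignment G → Fin (n G) → Fin (n G) → Assignment G
move G A v w = (A [ v ]%= (λ k → k ∸ 2)) [ w ]%= suc

Step : (G : Digraph) → Assignment G → Assignment G → Set
Step G A B = ∃[ v ] ∃[ w ] (Edge G v w × 2 ≤ lookup A v × B ≡ move G A v w)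

Reachable : (G : Digraph) → Assignment G → Assignment G → Set
Reachable G = Star (Step G)

FullyTraversable : (G : Digraph) → Assignment G → Set
FullyTraversable G S =
  (∃[ u ] ∃[ v ] Edge G u v) ×
  (∀ v w → Edge G v w → ∃[ A ] (Reachable G S A × 2 ≤ lookup A v))

-- G is isomorphic, as a directed graph, to the assignment graph [S]:
-- a bijection f from the vertices of G onto the assignments reachable
-- from S, such that (u , v) is an edge of G iff (f u , f v) is an edge of [S].
IsoToAssignmentGraph : (G : Digraph) → Assignment G → Set
IsoToAssignmentGraph G S =
  Σ (Fin (n G) → Assignment G) λ f →
    (∀ v → Reachable G S (f v)) ×
    (∀ u v → f u ≡ f v → u ≡ v) ×
    (∀ A → Reachable G S A → ∃[ v ] f v ≡ A) ×
    (∀ u v → Edge G u v ⇔ Step G (f u) (f v))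

{-# OPTIONS --safe #-}

-- Every pebbling move removes one pebble in total, so the total number of
-- pebbles strictly decreases along the edges of [S]; transported along an
-- isomorphism G ≅ [S] it is a potential that strictly decreases along the
-- edges of G.  At the vertex of an undirected cycle where this potential is
-- minimal both cycle edges point inwards, so G — and hence [S] — has a vertex
-- with two distinct in-neighbours.
--
-- On the other hand [S] has in-degree at most one.  Counting edges gives this:
-- [S] has as many edges as G, while every edge (p , q) of G is traversed by
-- at least one reachable assignment, and distinct moves from one assignment
-- give distinct assignments; hence every edge is traversed by exactly one
-- reachable assignment.  If A₁ ≠ A₂ both moved to Z, firing p and p' ≠ p, then
-- A₁ is the only assignment from which p fires, so p never fires on the way
-- to A₂ and p gains at least two pebbles on the way to A₁; but after the
-- first move into p only p can fire, which caps the gain at one.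

module Submission where

open import Defs
open import Data.Bool.Properties using (T?; T-irrelevant)
open import Data.Empty using (⊥-elim)
open import Data.Fin using (Fin; zero; suc; _≟_)
open import Data.Fin.Properties using (injective⇒≤; *↔×)
open import Data.List using ([]; _∷_; _++_; [_]; length)
open import Data.List.Extrema.Nat using (argmin; argmin-all; f[argmin]≤f[⊤]; f[argmin]≤f[xs])
open import Data.List.Membership.Propositional using (_∈_)
open import Data.List.Membership.Propositional.Properties using (∈-∃++)
open import Data.List.Properties using (++-assoc)
open import Data.List.Relation.Binary.Permutation.Propositional using (_↭_; ↭-refl; ↭-sym; ↭⇒↭ₛ)
open import Data.List.Relation.Binary.Permutation.Propositional.Properties using (++-comm; ↭-length; All-resp-↭)
import Data.List.Relation.Binary.Permutation.Setoid.Properties as Permutationₛ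
open import Data.List.Relation.Unary.All as All using (All; _∷_)
open import Data.List.Relation.Unary.AllPairs using (_∷_)
open import Data.List.Relation.Unary.Any using (here; there)
open import Data.List.Relation.Unary.Unique.Propositional using (Unique)
open import Data.Nat using (ℕ; suc; _+_; _∸_; _≤_; _<_; s≤s)
open import Data.Nat.Properties hiding (_≟_)
open import Data.Product using (∃-syntax; _×_; _,_; proj₁; proj₂)
open import Data.Sum using (_⊎_; inj₁; inj₂; swap)
open import Data.Unit using (tt)
open import Data.Vec using (Vec; _∷_; lookup; sum; _[_]%=_)
open import Data.Vec.Properties using (lookup∘updateAt; lookup∘updateAt′)
open import Function using (_∘_; _↔_; Inverse; Injection; Equivalence)
open import Function.Definitions using (Injective)
open import Function.Properties.Inverse using (↔-sym; ↔⇒↣)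
open import Relation.Binary.Construct.Closure.ReflexiveTransitive using (Star; ε; _◅_; _◅◅_)
open import Relation.Binary.PropositionalEquality
  using (_≡_; _≢_; refl; sym; trans; cong; subst; setoid; module ≡-Reasoning)
open import Relation.Nullary using (¬_; yes; no)

injective-self-map-misses-nothing : ∀ {k} {X : Set} → X ↔ Fin k →
  {g : X → X} → Injective _≡_ _≡_ g → ∀ x → ¬ (∀ y → g y ≢ x)
injective-self-map-misses-nothing {k} X↔Fin {g} g-injective x x-missed =
  1+n≰n (injective⇒≤ extended-injective)
  where
    open Inverse X↔Fin using (to; from)

    to-injective : Injective _≡_ _≡_ to
    to-injective = Injection.injective (↔⇒↣ X↔Fin)

    from-injective : Injective _≡_ _≡_ from
    from-injective = Injection.injective (↔⇒↣ (↔-sym X↔Fin))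

    extended : Fin (suc k) → Fin k
    extended zero    = to x
    extended (suc i) = to (g (from i))

    extended-injective : Injective _≡_ _≡_ extended
    extended-injective {zero}  {zero}  _  = refl
    extended-injective {zero}  {suc j} eq = ⊥-elim (x-missed (from j) (sym (to-injective eq)))
    extended-injective {suc i} {zero}  eq = ⊥-elim (x-missed (from i) (to-injective eq))
    extended-injective {suc i} {suc j} eq =
      cong suc (from-injective (g-injective (to-injective eq)))

suc[m∸2]<m : ∀ {m} → 2 ≤ m → suc (m ∸ 2) < m
suc[m∸2]<m (s≤s (s≤s {n = k} _)) = n<1+n (suc k)

sum-updateAt-suc : ∀ {k} (xs : Vec ℕ k) i → sum (xs [ i ]%= suc) ≡ suc (sum xs)
sum-updateAt-suc (x ∷ xs) zero    = refl
sum-updateAt-suc (x ∷ xs) (suc i) = trans (cong (x +_) (sum-updateAt-suc xs i)) (+-suc x (sum xs))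

sum-updateAt-∸2 : ∀ {k} (xs : Vec ℕ k) i → 2 ≤ lookup xs i → sum (xs [ i ]%= (_∸ 2)) + 2 ≡ sum xs
sum-updateAt-∸2 (x ∷ xs) zero 2≤x = begin
  x ∸ 2 + sum xs + 2 ≡⟨ +-assoc (x ∸ 2) (sum xs) 2 ⟩
  x ∸ 2 + (sum xs + 2) ≡⟨ cong (x ∸ 2 +_) (+-comm (sum xs) 2) ⟩
  x ∸ 2 + (2 + sum xs) ≡⟨ +-assoc (x ∸ 2) 2 (sum xs) ⟨
  x ∸ 2 + 2 + sum xs   ≡⟨ cong (_+ sum xs) (m∸n+n≡m 2≤x) ⟩
  x + sum xs           ∎
  where open ≡-Reasoning
sum-updateAt-∸2 (x ∷ xs) (suc i) 2≤xsᵢ =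
  trans (+-assoc x _ 2) (cong (x +_) (sum-updateAt-∸2 xs i 2≤xsᵢ))

module Moves (G : Digraph) where

  lookup-move-source : ∀ (A : Assignment G) {v w} → v ≢ w →
    lookup (move G A v w) v ≡ lookup A v ∸ 2
  lookup-move-source A {v} {w} v≢w =
    trans (lookup∘updateAt′ v w v≢w (A [ v ]%= (_∸ 2))) (lookup∘updateAt v A)

  lookup-move-target : ∀ (A : Assignment G) {v w} → v ≢ w →
    lookup (move G A v w) w ≡ suc (lookup A w)
  lookup-move-target A {v} {w} v≢w =
    trans (lookup∘updateAt w (A [ v ]%= (_∸ 2))) (cong suc (lookup∘updateAt′ w v (v≢w ∘ sym) A))

  lookup-move-other : ∀ (A : Assignment G) {v w x} → x ≢ v → x ≢ w →
    lookup (move G A v w) x ≡ lookup A x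
  lookup-move-other A {v} {w} {x} x≢v x≢w =
    trans (lookup∘updateAt′ x w x≢w (A [ v ]%= (_∸ 2))) (lookup∘updateAt′ x v x≢v A)

  lookup-move-≤-suc : ∀ (A : Assignment G) {v w} x → v ≢ w →
    lookup (move G A v w) x ≤ suc (lookup A x)
  lookup-move-≤-suc A {v} {w} x v≢w with x ≟ w | x ≟ v
  ... | yes refl | _        = ≤-reflexive (lookup-move-target A v≢w)
  ... | no _     | yes refl = ≤-trans (≤-reflexive (lookup-move-source A v≢w)) (m≤n⇒m≤1+n (m∸n≤m _ 2))
  ... | no x≢w   | no x≢v   = m≤n⇒m≤1+n (≤-reflexive (lookup-move-other A x≢v x≢w))

  lookup-move-≤ : ∀ (A : Assignment G) {v w x} → v ≢ w → x ≢ w →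
    lookup (move G A v w) x ≤ lookup A x
  lookup-move-≤ A {v} {w} {x} v≢w x≢w with x ≟ v
  ... | yes refl = ≤-trans (≤-reflexive (lookup-move-source A v≢w)) (m∸n≤m _ 2)
  ... | no x≢v   = ≤-reflexive (lookup-move-other A x≢v x≢w)

  lookup-≤-move : ∀ (A : Assignment G) {v w x} → v ≢ w → x ≢ v →
    lookup A x ≤ lookup (move G A v w) x
  lookup-≤-move A {v} {w} {x} v≢w x≢v with x ≟ w
  ... | yes refl = ≤-trans (n≤1+n _) (≤-reflexive (sym (lookup-move-target A v≢w)))
  ... | no x≢w   = ≤-reflexive (sym (lookup-move-other A x≢v x≢w))

  move≢ : ∀ (A : Assignment G) {v w} → v ≢ w → move G A v w ≢ A
  move≢ A {v} {w} v≢w eq =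
    1+n≢n (trans (sym (lookup-move-target A v≢w)) (cong (λ B → lookup B w) eq))

  move-injective : ∀ (A : Assignment G) {p q p' q'} → p ≢ q → p' ≢ q' → 2 ≤ lookup A p →
    move G A p q ≡ move G A p' q' → p ≡ p' × q ≡ q'
  move-injective A {p} {q} {p'} {q'} p≢q p'≢q' 2≤Aₚ eq with p ≟ p'
  ... | no p≢p' = ⊥-elim (<-irrefl refl (begin-strict
        lookup A p                 ≤⟨ lookup-≤-move A p'≢q' p≢p' ⟩
        lookup (move G A p' q') p  ≡⟨ cong (λ B → lookup B p) eq ⟨
        lookup (move G A p q) p    ≡⟨ lookup-move-source A p≢q ⟩
        lookup A p ∸ 2             <⟨ <-trans (n<1+n _) (suc[m∸2]<m 2≤Aₚ) ⟩
        lookup A p                 ∎))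
    where open ≤-Reasoning
  ... | yes refl with q ≟ q'
  ...   | yes refl = refl , refl
  ...   | no q≢q'  = ⊥-elim (1+n≢n (begin
          suc (lookup A q)          ≡⟨ lookup-move-target A p≢q ⟨
          lookup (move G A p q) q   ≡⟨ cong (λ B → lookup B q) eq ⟩
          lookup (move G A p q') q  ≡⟨ lookup-move-other A (p≢q ∘ sym) q≢q' ⟩
          lookup A q                ∎))
    where open ≡-Reasoning

  sum-move : ∀ (A : Assignment G) {v} w → 2 ≤ lookup A v → suc (sum (move G A v w)) ≡ sum A
  sum-move A {v} w 2≤Aᵥ = begin
    suc (sum (A′ [ w ]%= suc)) ≡⟨ cong suc (sum-updateAt-suc A′ w) ⟩
    2 + sum A′                 ≡⟨ +-comm 2 (sum A′) ⟩
    sum A′ + 2                 ≡⟨ sum-updateAt-∸2 A v 2≤Aᵥ ⟩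
    sum A                      ∎
    where
      open ≡-Reasoning
      A′ = A [ v ]%= (_∸ 2)

  sum-step : ∀ {A B} → Step G A B → suc (sum B) ≡ sum A
  sum-step {A} (_ , w , _ , 2≤Aᵥ , refl) = sum-move A w 2≤Aᵥ

  sum-star : ∀ {A B} → Star (Step G) A B → sum B ≤ sum A
  sum-star ε           = ≤-refl
  sum-star (st ◅ rest) = ≤-trans (sum-star rest) (<⇒≤ (≤-reflexive (sum-step st)))

module _ (G : Digraph) where

  Chain-++⁻ : ∀ as y bs → Chain G (as ++ y ∷ bs) → Chain G (as ++ [ y ]) × Chain G (y ∷ bs)
  Chain-++⁻ []           y bs c        = tt , c
  Chain-++⁻ (a ∷ [])     y bs (a~y , c) = (a~y , tt) , c
  Chain-++⁻ (a ∷ b ∷ as) y bs (a~b , c) with c₁ , c₂ ← Chain-++⁻ (b ∷ as) y bs c = (a~b , c₁) , c₂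

  Chain-++⁺ : ∀ as y bs → Chain G (as ++ [ y ]) → Chain G (y ∷ bs) → Chain G (as ++ y ∷ bs)
  Chain-++⁺ []           y bs _          c = c
  Chain-++⁺ (a ∷ [])     y bs (a~y , _)  c = a~y , c
  Chain-++⁺ (a ∷ b ∷ as) y bs (a~b , c₁) c = a~b , Chain-++⁺ (b ∷ as) y bs c₁ c

  last-adjacent : ∀ m a as → Chain G (a ∷ as ++ [ m ]) → ∃[ z ] (z ∈ a ∷ as × Adj G z m)
  last-adjacent m a []       (a~m , _) = a , here refl , a~m
  last-adjacent m a (b ∷ as) (_ , c) with z , z∈ , z~m ← last-adjacent m b as c = z , there z∈ , z~m

  rotate-closed-chain : ∀ {x xs m} → m ∈ x ∷ xs → Chain G (x ∷ xs ++ [ x ]) →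
    ∃[ ys ] (m ∷ ys ↭ x ∷ xs × Chain G (m ∷ ys ++ [ m ]))
  rotate-closed-chain {m = m} m∈ c with ∈-∃++ m∈
  ... | []      , post , refl = post , ↭-refl , c
  ... | x ∷ pre , post , refl
    with x-to-m , m-to-x ← Chain-++⁻ (x ∷ pre) m (post ++ [ x ])
                             (subst (λ l → Chain G (x ∷ l)) (++-assoc pre (m ∷ post) [ x ]) c) =
    post ++ x ∷ pre , ++-comm (m ∷ post) (x ∷ pre) ,
    subst (λ l → Chain G (m ∷ l)) (sym (++-assoc post (x ∷ pre) [ m ]))
          (Chain-++⁺ (m ∷ post) x (pre ++ [ m ]) m-to-x x-to-m)

module _ (G : Digraph) (h : Fin (n G) → ℕ) (h-decreasing : ∀ {u v} → Edge G u v → h v < h u) where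

  adjacent-to-lower : ∀ {u v} → Adj G u v → h u ≤ h v → Edge G v u
  adjacent-to-lower (inj₁ u→v) hu≤hv = ⊥-elim (<-irrefl refl (<-≤-trans (h-decreasing u→v) hu≤hv))
  adjacent-to-lower (inj₂ v→u) _     = v→u

  cycle-start-is-sink : ∀ {m ys} → 3 ≤ length (m ∷ ys) → Unique (m ∷ ys) →
    Chain G (m ∷ ys ++ [ m ]) → All (λ y → h m ≤ h y) ys →
    ∃[ a ] ∃[ c ] (a ≢ c × Edge G a m × Edge G c m)
  cycle-start-is-sink {ys = []}    (s≤s ())       _ _ _
  cycle-start-is-sink {ys = _ ∷ []} (s≤s (s≤s ())) _ _ _
  cycle-start-is-sink {m} {t ∷ t′ ∷ ts} _ (_ ∷ t∉ ∷ _) (m~t , _ , c) (m≤t ∷ m≤ts)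
    with z , z∈ , z~m ← last-adjacent G m t′ ts c =
    t , z , All.lookup t∉ z∈ , adjacent-to-lower m~t m≤t ,
    adjacent-to-lower (swap z~m) (All.lookup m≤ts z∈)

  minimal-vertex-of-cycle-is-sink : ∀ {x xs m} → 3 ≤ length (x ∷ xs) → Unique (x ∷ xs) →
    Chain G (x ∷ xs ++ [ x ]) → m ∈ x ∷ xs → All (λ y → h m ≤ h y) (x ∷ xs) →
    ∃[ a ] ∃[ c ] (a ≢ c × Edge G a m × Edge G c m)
  minimal-vertex-of-cycle-is-sink 3≤ unique c m∈ minimal
    with ys , ys↭xs , c′ ← rotate-closed-chain G m∈ c =
    cycle-start-is-sink (subst (3 ≤_) (sym (↭-length ys↭xs)) 3≤)
      (Permutationₛ.Unique-resp-↭ (setoid _) (↭⇒↭ₛ (↭-sym ys↭xs)) unique) c′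
      (All.tail (All-resp-↭ (↭-sym ys↭xs) minimal))

  undirected-cycle⇒converging-edges : HasUndirectedCycle G →
    ∃[ a ] ∃[ b ] ∃[ c ] (a ≢ c × Edge G a b × Edge G c b)
  undirected-cycle⇒converging-edges (x , xs , 3≤ , unique , c)
    with a , b , a≢b , a→m , b→m ← minimal-vertex-of-cycle-is-sink 3≤ unique c
           (argmin-all h (here refl) (All.tabulate there))
           (f[argmin]≤f[⊤] {f = h} x xs ∷ f[argmin]≤f[xs] {f = h} x xs)
    = a , argmin h x xs , b , a≢b , a→m , b→m

UniquelyTraversable : (G : Digraph) → Assignment G → Set
UniquelyTraversable G S = ∀ {A B p q} → Edge G p q → Reachable G S A → Reachable G S B →
  2 ≤ lookup A p → 2 ≤ lookup B p → A ≡ B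

module _ {G : Digraph} (loopless : ∀ v → ¬ Edge G v v) where

  open Moves G

  edge⇒≢ : ∀ {p q} → Edge G p q → p ≢ q
  edge⇒≢ {p} p→q refl = loopless p p→q

  lookup-≤-or-fired : ∀ {D C} p → Star (Step G) D C →
    lookup D p ≤ lookup C p ⊎ ∃[ E ] (Star (Step G) D E × 2 ≤ lookup E p × sum C < sum E)
  lookup-≤-or-fired p ε = inj₁ ≤-refl
  lookup-≤-or-fired {D} p (st@(x , y , x→y , 2≤Dₓ , refl) ◅ rest) with x ≟ p
  ... | yes refl = inj₂ (D , ε , 2≤Dₓ , ≤-trans (s≤s (sum-star rest)) (≤-reflexive (sum-step st)))
  ... | no x≢p with lookup-≤-or-fired p rest
  ...   | inj₁ Dₚ≤Cₚ = inj₁ (≤-trans (lookup-≤-move D (edge⇒≢ x→y) (x≢p ∘ sym)) Dₚ≤Cₚ)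
  ...   | inj₂ (E , path , 2≤Eₚ , C<E) = inj₂ (E , st ◅ path , 2≤Eₚ , C<E)

  module _ {S : Assignment G} (unique : UniquelyTraversable G S) where

    only-target-can-fire : ∀ {B x y z r} → Reachable G S B → Edge G x y → 2 ≤ lookup B x →
      Edge G z r → 2 ≤ lookup (move G B x y) z → z ≡ y
    only-target-can-fire {B} {x} {y} {z} rB x→y 2≤Bₓ z→r 2≤B′z with z ≟ y
    ... | yes z≡y = z≡y
    ... | no z≢y  = ⊥-elim (move≢ B (edge⇒≢ x→y)
          (unique z→r (rB ◅◅ (x , y , x→y , 2≤Bₓ , refl) ◅ ε) rB 2≤B′z
                  (≤-trans 2≤B′z (lookup-move-≤ B (edge⇒≢ x→y) z≢y))))

    firable-lookup-≤-suc : ∀ {D C p r} → Reachable G S D → Star (Step G) D C → Edge G p r →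
      2 ≤ lookup C p → lookup C p ≤ suc (lookup D p)
    firable-lookup-≤-suc _ ε _ _ = n≤1+n _
    firable-lookup-≤-suc {D} {p = p} rD (st@(x , y , x→y , 2≤Dₓ , refl) ◅ rest) p→r 2≤Cₚ with y ≟ p
    ... | no y≢p = ≤-trans (firable-lookup-≤-suc (rD ◅◅ st ◅ ε) rest p→r 2≤Cₚ)
                           (s≤s (lookup-move-≤ D (edge⇒≢ x→y) (y≢p ∘ sym)))
    ... | yes refl = subst (λ C → lookup C y ≤ suc (lookup D y)) (settled rest 2≤Cₚ)
                           (lookup-move-≤-suc D y (edge⇒≢ x→y))
      where
        rD′ : Reachable G S (move G D x y)
        rD′ = rD ◅◅ st ◅ ε

        settled : ∀ {C} → Star (Step G) (move G D x y) C → 2 ≤ lookup C y → move G D x y ≡ C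
        settled ε _ = refl
        settled path@((x′ , _ , x′→y′ , 2≤x′ , _) ◅ _) 2≤Cy =
          unique p→r rD′ (rD′ ◅◅ path)
            (subst (λ z → 2 ≤ lookup (move G D x y) z)
                   (only-target-can-fire rD x→y 2≤Dₓ x′→y′ 2≤x′) 2≤x′)
            2≤Cy

    in-degree-≤1 : ∀ {A₁ A₂ Z} → Reachable G S A₁ → Reachable G S A₂ →
      Step G A₁ Z → Step G A₂ Z → A₁ ≡ A₂
    in-degree-≤1 {A₁} {A₂} r₁ r₂ s₁@(p , q , p→q , 2≤A₁ₚ , refl) s₂@(p′ , q′ , p′→q′ , 2≤A₂ₚ′ , Z≡)
      with p ≟ p′
    ... | yes refl = unique p→q r₁ r₂ 2≤A₁ₚ 2≤A₂ₚ′
    ... | no p≢p′ with lookup-≤-or-fired p r₂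
    ...   | inj₂ (E , rE , 2≤Eₚ , A₂<E) = ⊥-elim (<-irrefl refl (begin-strict
            sum A₂                    <⟨ A₂<E ⟩
            sum E                     ≡⟨ cong sum (unique p→q rE r₁ 2≤Eₚ 2≤A₁ₚ) ⟩
            sum A₁                    ≡⟨ sum-step s₁ ⟨
            suc (sum (move G A₁ p q)) ≡⟨ sum-step s₂ ⟩
            sum A₂                    ∎))
      where open ≤-Reasoning
    ...   | inj₁ Sₚ≤A₂ₚ = ⊥-elim (<-irrefl refl (begin-strict
            lookup A₁ p                    ≤⟨ firable-lookup-≤-suc ε r₁ p→q 2≤A₁ₚ ⟩
            suc (lookup S p)               ≤⟨ s≤s Sₚ≤A₂ₚ ⟩
            suc (lookup A₂ p)              ≤⟨ s≤s (lookup-≤-move A₂ (edge⇒≢ p′→q′) p≢p′) ⟩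
            suc (lookup (move G A₂ p′ q′) p) ≡⟨ cong (λ B → suc (lookup B p)) Z≡ ⟨
            suc (lookup (move G A₁ p q) p) ≡⟨ cong suc (lookup-move-source A₁ (edge⇒≢ p→q)) ⟩
            suc (lookup A₁ p ∸ 2)          <⟨ suc[m∸2]<m 2≤A₁ₚ ⟩
            lookup A₁ p                    ∎))
      where open ≤-Reasoning

  module _ {S : Assignment G}
    (traversable : ∀ v w → Edge G v w → ∃[ A ] (Reachable G S A × 2 ≤ lookup A v))
    (f : Fin (n G) → Assignment G) (f-reachable : ∀ v → Reachable G S (f v))
    (f-onto : ∀ A → Reachable G S A → ∃[ v ] f v ≡ A)
    (f-reflects-step : ∀ u v → Step G (f u) (f v) → Edge G u v) where

    private
      V : Set
      V = Fin (n G)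

    traverser : ∀ {p q} → Edge G p q → ∃[ u ] 2 ≤ lookup (f u) p
    traverser e with A , rA , 2≤Aₚ ← traversable _ _ e with u , refl ← f-onto A rA = u , 2≤Aₚ

    fire : ∀ u {p q} → Edge G p q → 2 ≤ lookup (f u) p → ∃[ v ] f v ≡ move G (f u) p q
    fire u {p} {q} p→q 2≤ = f-onto _ (f-reachable u ◅◅ (p , q , p→q , 2≤ , refl) ◅ ε)

    fire-edge : ∀ u {p q} (p→q : Edge G p q) (2≤ : 2 ≤ lookup (f u) p) →
      Edge G u (proj₁ (fire u p→q 2≤))
    fire-edge u {p} {q} p→q 2≤ =
      f-reflects-step u _ (p , q , p→q , 2≤ , proj₂ (fire u p→q 2≤))

    fire-injective : ∀ {u u′ p q p′ q′} (p→q : Edge G p q) (p′→q′ : Edge G p′ q′) 2≤ 2≤′ →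
      u ≡ u′ →
      proj₁ (fire u p→q 2≤) ≡ proj₁ (fire u′ p′→q′ 2≤′) → p ≡ p′ × q ≡ q′
    fire-injective {u} p→q p′→q′ 2≤ 2≤′ refl eq =
      move-injective (f u) (edge⇒≢ p→q) (edge⇒≢ p′→q′) 2≤
        (trans (sym (proj₂ (fire u p→q 2≤))) (trans (cong f eq) (proj₂ (fire u p′→q′ 2≤′))))

    -- The edges of [S] pulled back to G, extended by the identity on non-edges
    -- so that it becomes a self-map of the finite set V × V.
    traverse : V × V → V × V
    traverse (p , q) with T? (adj G p q)
    ... | yes p→q = proj₁ (traverser p→q) , proj₁ (fire _ p→q (proj₂ (traverser p→q)))
    ... | no _    = p , q

    traverse-edge : ∀ {p q} (p→q : Edge G p q) →
      Edge G (proj₁ (traverser p→q)) (proj₁ (fire _ p→q (proj₂ (traverser p→q))))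
    traverse-edge p→q = fire-edge _ p→q (proj₂ (traverser p→q))

    traverse-injective : Injective _≡_ _≡_ traverse
    traverse-injective {p , q} {p′ , q′} eq with T? (adj G p q) | T? (adj G p′ q′)
    ... | yes p→q | yes p′→q′
      with refl , refl ← fire-injective p→q p′→q′ _ _ (cong proj₁ eq) (cong proj₂ eq) = refl
    ... | yes p→q | no ¬p′→q′ =
      ⊥-elim (¬p′→q′ (subst (λ (a , b) → Edge G a b) eq (traverse-edge p→q)))
    ... | no ¬p→q | yes p′→q′ =
      ⊥-elim (¬p→q (subst (λ (a , b) → Edge G a b) (sym eq) (traverse-edge p′→q′)))
    ... | no _    | no _      = eq

    traverser-unique : ∀ {u p q} (p→q : Edge G p q) → 2 ≤ lookup (f u) p → u ≡ proj₁ (traverser p→q)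
    traverser-unique {u} p→q 2≤ with u ≟ proj₁ (traverser p→q)
    ... | yes u≡ = u≡
    ... | no u≢ = ⊥-elim (injective-self-map-misses-nothing (↔-sym *↔×) traverse-injective
                    (u , proj₁ (fire u p→q 2≤)) missed)
      where
        missed : ∀ x → traverse x ≢ (u , proj₁ (fire u p→q 2≤))
        missed (a , b) eq with T? (adj G a b)
        ... | no ¬a→b = ¬a→b (subst (λ (a , b) → Edge G a b) (sym eq) (fire-edge u p→q 2≤))
        ... | yes a→b
          with refl , refl ← fire-injective a→b p→q _ 2≤ (cong proj₁ eq) (cong proj₂ eq) =
          u≢ (trans (sym (cong proj₁ eq)) (cong (proj₁ ∘ traverser) (T-irrelevant a→b p→q)))

    iso⇒uniquely-traversable : UniquelyTraversable G S
    iso⇒uniquely-traversable p→q rA rB 2≤Aₚ 2≤Bₚ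
      with u , refl ← f-onto _ rA | v , refl ← f-onto _ rB =
      cong f (trans (traverser-unique p→q 2≤Aₚ) (sym (traverser-unique p→q 2≤Bₚ)))

theorem4p1 : (G : Digraph) → IsOriented G → (S : Assignment G) →
    FullyTraversable G S → HasUndirectedCycle G →
    ¬ IsoToAssignmentGraph G S
theorem4p1 G (loopless , _) S (_ , traversable) cycle (f , f-reachable , f-injective , f-onto , f-iso)
  with a , b , c , a≢c , a→b , c→b ← undirected-cycle⇒converging-edges G (λ v → sum (f v))
         (λ {u} {v} u→v → ≤-reflexive (Moves.sum-step G (Equivalence.to (f-iso u v) u→v))) cycle
  = a≢c (f-injective a c (in-degree-≤1 loopless unique (f-reachable a) (f-reachable c)
          (Equivalence.to (f-iso a b) a→b) (Equivalence.to (f-iso c b) c→b)))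
  where
    unique : UniquelyTraversable G S
    unique = iso⇒uniquely-traversable loopless traversable f f-reachable f-onto
               (λ u v → Equivalence.from (f-iso u v))
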